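{- Let $q\ge2$ be a power of a prime and let $j\geq 2$ be an integer. For $m,n\in\mathbb{N}^*$ let $b_{j,m,n}$ and $l_{j,m,n}$ be as defined in the context. Consider the statements: $P(n)$: for all $m\in\mathbb{N}^*$ with $m\geq n-1$, $b_{j,m,n}$ is defined and $b_{j,m+1,n}=b_{j,m,n}+q^{j+m+1-n}$. $Q(n)$: for all $m\geq n$, $l_{j,m,n}=\max\{l\in\mathbb{N}^*: b_{j,m,n}\geq q^l-1\}=j+m-n$ and $b_{j,m,n}-(q^{l_{j,m,n}}-1)\leq[1^{l_{j,m,n}-1}0]_q$; consequently $b_{j,m,n+1}=b_{j,m,n}-(q^{j+m-n}-1)$. $R(n)$: for all $m\in\mathbb{N}^*$ with $m\geq n-1$, $b_{j,m+1,n+1}=b_{j,m,n}+1$. Then $P(n)$ holds for all $1\leq n\leq q^{j-1}+1$, and $Q(n)$ and $R(n)$ hold for all $1\leq n\leq q^{j-1}$.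
   Context: For a word $w$ over $\{0,\dots,q-1\}$, $[w]_q$ is the integer whose base-$q$ expansion is $w$, and $x^m$ denotes $m$ copies of the letter $x$ (so $[1^00]_q=0$). Fix an integer $s$ with $1<s<q$ and put $\bar{s}=q-s$. Decomposition procedure: given a positive integer $b$, set $b_1=b$. Inductively, if $b_i$ has been defined and $b_i\ge q-1$ (i.e. there is $l\in\mathbb{N}^*$ with $b_i\ge q^l-1$), let $l_i=\max\{l\in\mathbb{N}^*: b_i\geq q^l-1\}$; if $b_i-(q^{l_i}-1)>[1^{l_i-1}0]_q$ the procedure stops, otherwise set $b_{i+1}=b_i-(q^{l_i}-1)$ and continue. If $b_i<q-1$ the procedure stops. For $j,m\in\mathbb{N}^*$, $b_{j,m,n}$ denotes the term $b_n$ produced by this procedure with input $b_1=[1^m0^j]_q$ ($b_{j,m,n}$ is undefined if the procedure stops before producing $b_n$), and $l_{j,m,n}$ denotes the corresponding $l_n$. -}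

module Defs where

open import Data.Nat using (ℕ; zero; suc; _+_; _*_; _∸_; _^_; _≤_; _<_)
open import Data.Nat.Primality using (Prime)
open import Data.List using (List; replicate; foldl; _++_)
open import Data.Product using (Σ; ∃; _×_)
open import Relation.Binary.PropositionalEquality using (_≡_)

IsPrimePower : ℕ → Set
IsPrimePower q = Σ ℕ λ p → Σ ℕ λ k → Prime p × 1 ≤ k × q ≡ p ^ k

-- [w]_q : integer with base-q expansion w (most significant digit first)
⟦_⟧_ : List ℕ → ℕ → ℕ
⟦ w ⟧ q = foldl (λ acc d → acc * q + d) 0 w

start : ℕ → ℕ → ℕ → ℕ
start q j m = ⟦ replicate m 1 ++ replicate j 0 ⟧ q

IsMaxL : ℕ → ℕ → ℕ → Set
IsMaxL q b l = 1 ≤ l × (q ^ l ∸ 1 ≤ b) × (∀ l' → 1 ≤ l' → q ^ l' ∸ 1 ≤ b → l' ≤ l)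

-- one step of the decomposition procedure: b_i ↦ b_{i+1} with l_i = l
-- (requires b_i ≥ q-1, which IsMaxL entails, and that the procedure does not stop)
Step : ℕ → ℕ → ℕ → ℕ → Set
Step q b l b' = IsMaxL q b l
              × (b ∸ (q ^ l ∸ 1) ≤ ⟦ replicate (l ∸ 1) 1 ++ replicate 1 0 ⟧ q)
              × b' ≡ b ∸ (q ^ l ∸ 1)

-- Term q b n x : the procedure started at b_1 = b produces b_n = x (n ≥ 1)
data Term (q b : ℕ) : ℕ → ℕ → Set where
  first : Term q b 1 b
  next  : ∀ {n x l y} → Term q b n x → Step q x l y → Term q b (suc n) y

-- b_{j,m,n} = x  (in particular b_{j,m,n} is defined)
B : ℕ → ℕ → ℕ → ℕ → ℕ → Set
B q j m n x = Term q (start q j m) n x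

module Submission where

-- Write q = e + 2, j = i + 2 and [1^r]_q = repunit q r, so that
-- the starting value is  b_{j,m,1} = [1^m 0^j]_q = repunit q m * q^j.
-- The whole lemma follows from one closed formula:
--
--     b_{j, r+c, c+1} = [1^r 0^j]_q + c      for all r and all c ≤ q^(j-1).
--
-- The inductive step is a single step of
-- the procedure: for c < q^(j-1) the value x = [1^(r+1) 0^j]_q + c satisfies
-- q^(j+r) - 1 ≤ x < q^(j+r+1) - 1, so its maximal exponent is j + r, and the
-- remainder x - (q^(j+r) - 1) = [1^r 0^j]_q + (c + 1) is at most
-- [1^(j+r-1) 0]_q, so the procedure continues.

open import Defs
open import Data.Nat
open import Data.Nat.Properties
open import Data.List using (replicate; foldl; _++_)
open import Data.List.Properties using (foldl-++)
open import Data.Nat.Primality using (prime)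
open import Data.Product using (Σ; _×_; _,_)
open import Relation.Binary.PropositionalEquality
open import Relation.Nullary using (yes; no)
open import Data.Empty using (⊥-elim)
open import Data.Nat.Tactic.RingSolver using (solve-∀)

-- A prime power q = p^k (k ≥ 1) is at least 2; this is the only property of
-- prime powers the lemma needs.
primePower≥2 : ∀ {q} → IsPrimePower q → 2 ≤ q
primePower≥2 (p , suc k , prime ⦃ nt ⦄ _ , _ , refl) = begin
    2           ≤⟨ nonTrivial⇒n>1 p ⦃ nt ⦄ ⟩
    p           ≡⟨ sym (*-identityʳ p) ⟩
    p ^ 1       ≤⟨ ^-monoʳ-≤ p ⦃ nonTrivial⇒nonZero p ⦃ nt ⦄ ⦄ (s≤s {0} {k} z≤n) ⟩
    p ^ suc k   ∎
  where open ≤-Reasoning hiding (start)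

module Digits (q : ℕ) where

  repunit : ℕ → ℕ
  repunit zero    = 0
  repunit (suc r) = q ^ r + repunit r

  private
    shift : ℕ → ℕ → ℕ
    shift acc d = acc * q + d

    read-ones : ∀ a r → foldl shift a (replicate r 1) ≡ a * q ^ r + repunit r
    read-ones a zero    = sym (trans (+-identityʳ (a * 1)) (*-identityʳ a))
    read-ones a (suc r) = trans (read-ones (a * q + 1) r) (reassoc a q (q ^ r) (repunit r))
      where
      reassoc : ∀ a q Q R → (a * q + 1) * Q + R ≡ a * (q * Q) + (Q + R)
      reassoc = solve-∀

    read-zeros : ∀ a k → foldl shift a (replicate k 0) ≡ a * q ^ k
    read-zeros a zero    = sym (*-identityʳ a)
    read-zeros a (suc k) = trans (read-zeros (a * q + 0) k) (reassoc a q (q ^ k))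
      where
      reassoc : ∀ a q Q → (a * q + 0) * Q ≡ a * (q * Q)
      reassoc = solve-∀

  ones-zeros : ∀ r k → ⟦ replicate r 1 ++ replicate k 0 ⟧ q ≡ repunit r * q ^ k
  ones-zeros r k = begin
      foldl shift 0 (replicate r 1 ++ replicate k 0)
    ≡⟨ foldl-++ shift 0 (replicate r 1) (replicate k 0) ⟩
      foldl shift (foldl shift 0 (replicate r 1)) (replicate k 0)
    ≡⟨ read-zeros _ k ⟩
      foldl shift 0 (replicate r 1) * q ^ k
    ≡⟨ cong (_* q ^ k) (read-ones 0 r) ⟩
      repunit r * q ^ k
    ∎
    where open ≡-Reasoning

  repunit-+ : ∀ a b → repunit (a + b) ≡ repunit a + q ^ a * repunit b
  repunit-+ a zero = begin
      repunit (a + 0)          ≡⟨ cong repunit (+-identityʳ a) ⟩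
      repunit a                ≡⟨ sym (+-identityʳ (repunit a)) ⟩
      repunit a + 0            ≡⟨ cong (repunit a +_) (sym (*-zeroʳ (q ^ a))) ⟩
      repunit a + q ^ a * 0    ∎
    where open ≡-Reasoning
  repunit-+ a (suc b) = begin
      repunit (a + suc b)                         ≡⟨ cong repunit (+-suc a b) ⟩
      q ^ (a + b) + repunit (a + b)               ≡⟨ cong₂ _+_ (^-distribˡ-+-* q a b) (repunit-+ a b) ⟩
      q ^ a * q ^ b + (repunit a + q ^ a * repunit b)
                                                  ≡⟨ regroup (q ^ a) (q ^ b) (repunit a) (repunit b) ⟩
      repunit a + q ^ a * (q ^ b + repunit b)     ∎
    where
    open ≡-Reasoning
    regroup : ∀ A B R S → A * B + (R + A * S) ≡ R + A * (B + S)
    regroup = solve-∀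

  power≤repunit*q : ∀ k → q ^ suc k ≤ repunit (suc k) * q
  power≤repunit*q k = begin
      q * q ^ k                  ≡⟨ *-comm q (q ^ k) ⟩
      q ^ k * q                  ≤⟨ *-monoˡ-≤ q (m≤m+n (q ^ k) (repunit k)) ⟩
      (q ^ k + repunit k) * q    ∎
    where open ≤-Reasoning hiding (start)

  start-suc : ∀ j r → start q j (suc r) ≡ q ^ (j + r) + start q j r
  start-suc j r = begin
      start q j (suc r)                    ≡⟨ ones-zeros (suc r) j ⟩
      (q ^ r + repunit r) * q ^ j          ≡⟨ *-distribʳ-+ (q ^ j) (q ^ r) (repunit r) ⟩
      q ^ r * q ^ j + repunit r * q ^ j    ≡⟨ cong₂ _+_ (*-comm (q ^ r) (q ^ j)) (sym (ones-zeros r j)) ⟩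
      q ^ j * q ^ r + start q j r          ≡⟨ cong (_+ start q j r) (sym (^-distribˡ-+-* q j r)) ⟩
      q ^ (j + r) + start q j r            ∎
    where open ≡-Reasoning

  start-suc-+ : ∀ j r c → start q j (suc r) + c ≡ q ^ (j + r) + (start q j r + c)
  start-suc-+ j r c = trans (cong (_+ c) (start-suc j r)) (+-assoc (q ^ (j + r)) _ c)

open Digits

repunit-geometric : ∀ d k → repunit (suc d) k * d + 1 ≡ suc d ^ k
repunit-geometric d zero    = refl
repunit-geometric d (suc k) = begin
    (Q + repunit q k) * d + 1      ≡⟨ expand Q (repunit q k) d ⟩
    Q * d + (repunit q k * d + 1)  ≡⟨ cong (Q * d +_) (repunit-geometric d k) ⟩
    Q * d + Q                      ≡⟨ collect Q d ⟩
    suc d * Q                      ∎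
  where
  open ≡-Reasoning
  q = suc d
  Q = q ^ k
  expand : ∀ Q R d → (Q + R) * d + 1 ≡ Q * d + (R * d + 1)
  expand = solve-∀
  collect : ∀ Q d → Q * d + Q ≡ suc d * Q
  collect = solve-∀

isMaxL-intro : ∀ q .{{_ : NonZero q}} x l → 1 ≤ l →
               q ^ l ∸ 1 ≤ x → 2 + x ≤ q ^ suc l → IsMaxL q x l
isMaxL-intro q x l l≥1 lower upper = l≥1 , lower , maximal
  where
  maximal : ∀ l' → 1 ≤ l' → q ^ l' ∸ 1 ≤ x → l' ≤ l
  maximal l' _ reached with l' ≤? l
  ... | yes l'≤l = l'≤l
  ... | no  l'≰l = ⊥-elim (<-irrefl refl (begin-strict
      x                 <⟨ ∸-monoˡ-≤ 1 upper ⟩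
      q ^ suc l ∸ 1     ≤⟨ ∸-monoˡ-≤ 1 (^-monoʳ-≤ q (≰⇒> l'≰l)) ⟩
      q ^ l' ∸ 1        ≤⟨ reached ⟩
      x                 ∎))
    where open ≤-Reasoning hiding (start)

+∸pred : ∀ P y → 1 ≤ P → (P + y) ∸ (P ∸ 1) ≡ suc y
+∸pred (suc P) y _ = trans (cong (_∸ P) (sym (+-suc P y))) (m+n∸m≡n P (suc y))

-- The three statements of the lemma, for fixed n and m.  The exponents are
-- kept as parameters so that reindexing only has to rewrite them once.

-- P: b_{j,m,n} is defined and b_{j,m+1,n} = b_{j,m,n} + q^k  (k = j+m+1-n)
P-at : (q j n m k : ℕ) → Set
P-at q j n m k = Σ ℕ λ x → B q j m n x × B q j (suc m) n (x + q ^ k)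

-- Q: l_{j,m,n} = l (l = j+m-n), the procedure continues, and b_{j,m,n+1} is the remainder
Q-at : (q j n m l : ℕ) → Set
Q-at q j n m l = Σ ℕ λ x → B q j m n x
  × IsMaxL q x l
  × Step q x l (x ∸ (q ^ l ∸ 1))
  × B q j m (suc n) (x ∸ (q ^ l ∸ 1))

R-at : (q j n m : ℕ) → Set
R-at q j n m = Σ ℕ λ x → B q j m n x × B q j (suc m) (suc n) (x + 1)

module Decomposition (e i : ℕ) where

  q j : ℕ
  q = suc (suc e)
  j = suc (suc i)

  counter-margin : ∀ {c} → suc c ≤ q ^ suc i → 2 + c ≤ q ^ j
  counter-margin {c} c<Q = begin
      suc (suc c)               ≤⟨ s≤s c<Q ⟩
      suc Q                     ≤⟨ +-monoˡ-≤ Q (m^n>0 q (suc i)) ⟩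
      Q + Q                     ≤⟨ +-monoʳ-≤ Q (m≤m+n Q _) ⟩
      q * Q                     ∎
    where
    open ≤-Reasoning hiding (start)
    Q = q ^ suc i

  module OneStep (r c : ℕ) (c<Q : suc c ≤ q ^ suc i) where

    x : ℕ
    x = start q j (suc r) + c

    -- x lies below q^(j+r+1) - 1, using (q - 1) [1^(r+1)]_q + 1 = q^(r+1)
    x-upper : 2 + x ≤ q ^ suc (j + r)
    x-upper = begin
        2 + x                             ≡⟨ cong (λ s → 2 + (s + c)) (ones-zeros q (suc r) j) ⟩
        2 + (G * q ^ j + c)               ≡⟨ shuffle (G * q ^ j) c ⟩
        G * q ^ j + (2 + c)               ≤⟨ +-monoʳ-≤ (G * q ^ j) (counter-margin c<Q) ⟩
        G * q ^ j + q ^ j                 ≡⟨ collect G (q ^ j) ⟩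
        (G + 1) * q ^ j                   ≤⟨ *-monoˡ-≤ (q ^ j) (+-monoˡ-≤ 1 (m≤m*n G (suc e))) ⟩
        (G * suc e + 1) * q ^ j           ≡⟨ cong (_* q ^ j) (repunit-geometric (suc e) (suc r)) ⟩
        q ^ suc r * q ^ j                 ≡⟨ sym (^-distribˡ-+-* q (suc r) j) ⟩
        q ^ (suc r + j)                   ≡⟨ cong (λ k → q ^ suc k) (+-comm r j) ⟩
        q ^ suc (j + r)                   ∎
      where
      open ≤-Reasoning hiding (start)
      G = repunit q (suc r)
      shuffle : ∀ A c → 2 + (A + c) ≡ A + (2 + c)
      shuffle = solve-∀
      collect : ∀ A B → A * B + B ≡ (A + 1) * B
      collect = solve-∀

    x-isMaxL : IsMaxL q x (j + r)
    x-isMaxL = isMaxL-intro q x (j + r) (s≤s z≤n) x-lower x-upper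
      where
      x-lower : q ^ (j + r) ∸ 1 ≤ x
      x-lower = ≤-trans (m∸n≤m _ 1) (subst (q ^ (j + r) ≤_) (sym (start-suc-+ q j r c)) (m≤m+n _ _))

    remainder : x ∸ (q ^ (j + r) ∸ 1) ≡ start q j r + suc c
    remainder = begin
        x ∸ (q ^ (j + r) ∸ 1)                          ≡⟨ cong (_∸ (q ^ (j + r) ∸ 1)) (start-suc-+ q j r c) ⟩
        q ^ (j + r) + (start q j r + c) ∸ (q ^ (j + r) ∸ 1)
                                                       ≡⟨ +∸pred (q ^ (j + r)) _ (m^n>0 q (j + r)) ⟩
        suc (start q j r + c)                          ≡⟨ sym (+-suc _ c) ⟩
        start q j r + suc c                            ∎
      where open ≡-Reasoning

    remainder-small : start q j r + suc c ≤ ⟦ replicate (j + r ∸ 1) 1 ++ replicate 1 0 ⟧ q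
    remainder-small = begin
        start q j r + suc c                        ≡⟨ cong (_+ suc c) (ones-zeros q r j) ⟩
        repunit q r * (q * Q) + suc c              ≤⟨ +-monoʳ-≤ _ (≤-trans c<Q (power≤repunit*q q i)) ⟩
        repunit q r * (q * Q) + repunit q (suc i) * q
                                                   ≡⟨ regroup (repunit q r) q Q (repunit q (suc i)) ⟩
        (repunit q (suc i) + Q * repunit q r) * q  ≡⟨ cong (_* q) (sym (repunit-+ q (suc i) r)) ⟩
        repunit q (suc i + r) * q                  ≡⟨ sym (ones-zero (suc i + r)) ⟩
        ⟦ replicate (suc i + r) 1 ++ replicate 1 0 ⟧ q ∎
      where
      open ≤-Reasoning hiding (start)
      Q = q ^ suc i
      regroup : ∀ R q Q S → R * (q * Q) + S * q ≡ (S + Q * R) * q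
      regroup = solve-∀
      ones-zero : ∀ k → ⟦ replicate k 1 ++ replicate 1 0 ⟧ q ≡ repunit q k * q
      ones-zero k = trans (ones-zeros q k 1) (cong (repunit q k *_) (*-identityʳ q))

    step : Step q x (j + r) (x ∸ (q ^ (j + r) ∸ 1))
    step = x-isMaxL , subst (_≤ ⟦ replicate (j + r ∸ 1) 1 ++ replicate 1 0 ⟧ q) (sym remainder) remainder-small , refl

  open OneStep using (x-isMaxL; remainder; step)

  closed-form : ∀ c r → c ≤ q ^ suc i → B q j (r + c) (suc c) (start q j r + c)
  closed-form zero r _ =
    subst₂ (λ m b → B q j m 1 b) (sym (+-identityʳ r)) (sym (+-identityʳ _)) first
  closed-form (suc c) r c<Q =
    subst₂ (λ m b → B q j m (suc (suc c)) b) (sym (+-suc r c)) (remainder r c c<Q)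
      (next (closed-form c (suc r) (≤-trans (n≤1+n c) c<Q)) (step r c c<Q))

  private
    exponent-P : ∀ r c → j + (r + c) + 1 ∸ suc c ≡ j + r
    exponent-P r c = trans (cong (_∸ suc c) (regroup j r c)) (m+n∸n≡m (j + r) (suc c))
      where
      regroup : ∀ a r c → a + (r + c) + 1 ≡ a + r + suc c
      regroup = solve-∀

    exponent-Q : ∀ r c → j + (suc r + c) ∸ suc c ≡ j + r
    exponent-Q r c = trans (cong (_∸ suc c) (regroup j r c)) (m+n∸n≡m (j + r) (suc c))
      where
      regroup : ∀ a r c → a + (suc r + c) ≡ a + r + suc c
      regroup = solve-∀

  P-closed : ∀ r c → c ≤ q ^ suc i → P-at q j (suc c) (r + c) (j + (r + c) + 1 ∸ suc c)
  P-closed r c c≤Q = subst (P-at q j (suc c) (r + c)) (sym (exponent-P r c))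
    (start q j r + c , closed-form c r c≤Q ,
     subst (B q j (suc (r + c)) (suc c)) next-value (closed-form c (suc r) c≤Q))
    where
    next-value : start q j (suc r) + c ≡ start q j r + c + q ^ (j + r)
    next-value = trans (start-suc-+ q j r c) (+-comm (q ^ (j + r)) _)

  Q-closed : ∀ r c → suc c ≤ q ^ suc i → Q-at q j (suc c) (suc r + c) (j + (suc r + c) ∸ suc c)
  Q-closed r c c<Q = subst (Q-at q j (suc c) (suc r + c)) (sym (exponent-Q r c))
    (_ , b , x-isMaxL r c c<Q , step r c c<Q , next b (step r c c<Q))
    where
    b = closed-form c (suc r) (≤-trans (n≤1+n c) c<Q)

  R-closed : ∀ r c → suc c ≤ q ^ suc i → R-at q j (suc c) (r + c)
  R-closed r c c<Q = start q j r + c , closed-form c r (≤-trans (n≤1+n c) c<Q) ,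
    subst₂ (λ m b → B q j m (suc (suc c)) b) (+-suc r c) increment (closed-form (suc c) r c<Q)
    where
    increment : start q j r + suc c ≡ start q j r + c + 1
    increment = sym (trans (+-assoc (start q j r) c 1) (cong (start q j r +_) (+-comm c 1)))

  -- back to arbitrary (n, m): write n = c + 1 and m = (m - c) + c
  P-holds : (n : ℕ) → 1 ≤ n → n ≤ q ^ (j ∸ 1) + 1 →
            (m : ℕ) → 1 ≤ m → n ∸ 1 ≤ m → P-at q j n m (j + m + 1 ∸ n)
  P-holds (suc c) _ n≤Q+1 m _ c≤m =
    subst (λ m → P-at q j (suc c) m (j + m + 1 ∸ suc c)) (m∸n+n≡m c≤m)
      (P-closed (m ∸ c) c (≤-pred (subst (suc c ≤_) (+-comm _ 1) n≤Q+1)))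

  Q-holds : (n : ℕ) → 1 ≤ n → n ≤ q ^ (j ∸ 1) →
            (m : ℕ) → n ≤ m → Q-at q j n m (j + m ∸ n)
  Q-holds (suc c) _ n≤Q m n≤m =
    subst (λ m → Q-at q j (suc c) m (j + m ∸ suc c))
      (trans (sym (+-suc (m ∸ suc c) c)) (m∸n+n≡m n≤m))
      (Q-closed (m ∸ suc c) c n≤Q)

  R-holds : (n : ℕ) → 1 ≤ n → n ≤ q ^ (j ∸ 1) →
            (m : ℕ) → 1 ≤ m → n ∸ 1 ≤ m → R-at q j n m
  R-holds (suc c) _ n≤Q m _ c≤m =
    subst (R-at q j (suc c)) (m∸n+n≡m c≤m) (R-closed (m ∸ c) c n≤Q)

lemma3 : (q j : ℕ) → IsPrimePower q → 2 ≤ j →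
    ((n : ℕ) → 1 ≤ n → n ≤ q ^ (j ∸ 1) + 1 →
      (m : ℕ) → 1 ≤ m → n ∸ 1 ≤ m →
        Σ ℕ λ x → B q j m n x × B q j (suc m) n (x + q ^ (j + m + 1 ∸ n)))
    ×
    ((n : ℕ) → 1 ≤ n → n ≤ q ^ (j ∸ 1) →
      (m : ℕ) → n ≤ m →
        Σ ℕ λ x → B q j m n x
          × IsMaxL q x (j + m ∸ n)
          × Step q x (j + m ∸ n) (x ∸ (q ^ (j + m ∸ n) ∸ 1))
          × B q j m (suc n) (x ∸ (q ^ (j + m ∸ n) ∸ 1)))
    ×
    ((n : ℕ) → 1 ≤ n → n ≤ q ^ (j ∸ 1) →
      (m : ℕ) → 1 ≤ m → n ∸ 1 ≤ m →
        Σ ℕ λ x → B q j m n x × B q j (suc m) (suc n) (x + 1))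
lemma3 q j q-primePower j≥2 = from-bounds (primePower≥2 q-primePower) j≥2
  where
  from-bounds : ∀ {q j} → 2 ≤ q → 2 ≤ j →
        ((n : ℕ) → 1 ≤ n → n ≤ q ^ (j ∸ 1) + 1 →
          (m : ℕ) → 1 ≤ m → n ∸ 1 ≤ m → P-at q j n m (j + m + 1 ∸ n))
        × ((n : ℕ) → 1 ≤ n → n ≤ q ^ (j ∸ 1) →
          (m : ℕ) → n ≤ m → Q-at q j n m (j + m ∸ n))
        × ((n : ℕ) → 1 ≤ n → n ≤ q ^ (j ∸ 1) →
          (m : ℕ) → 1 ≤ m → n ∸ 1 ≤ m → R-at q j n m)
  from-bounds {suc (suc e)} {suc (suc i)} (s≤s (s≤s _)) (s≤s (s≤s _)) = P-holds , Q-holds , R-holds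
    where open Decomposition e i
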